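{- Let $n\geq 1$ be an integer and let $F_1(n)=\prod_{k=1}^n k^{k!}$, $F_2(n)=\prod_{k=1}^n (k!)^{k}$ and $F_3(n)=\prod_{k=1}^n (k!)^{k!}$. Then $$\prod_{k=1}^nk^{k^{k/2}}\leq F_1(n)\leq\prod_{k=1}^nk^{\left(\frac{k+1}{2}\right)^k},\qquad \prod_{k=1}^nk^{k^2/2}\leq F_2(n)\leq\prod_{k=1}^n\left(\frac{k+1}{2}\right)^{k^2},$$ and $$\prod_{k=1}^nk^{\frac{1}{2}k^{1+\frac{k}{2}}}\leq F_3(n)\leq\prod_{k=1}^n\left(\frac{k+1}{2}\right)^{k\left(\frac{k+1}{2}\right)^k}.$$ -}

module Defs where

open import Data.Nat using (ℕ; zero; suc; _+_; _*_; _∸_; _^_; _≤_; _!)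


prod : ℕ → (ℕ → ℕ) → ℕ
prod zero    f = 1
prod (suc n) f = prod n f * f (suc n)

F₁ F₂ F₃ : ℕ → ℕ
F₁ n = prod n (λ k → k ^ (k !))
F₂ n = prod n (λ k → (k !) ^ k)
F₃ n = prod n (λ k → (k !) ^ (k !))

-- SqrtExpProdLE n d m N  encodes the real inequality
--     ∏_{k=1}^{n} k ^ ( √(m k) / d k )  ≤  N
-- via rational lower approximations of the exponents with a common
-- denominator b:  whenever a k / b ≤ √(m k) / d k for all 1 ≤ k ≤ n
-- (i.e. (d k * a k)² ≤ b² * m k), we have ∏ k ^ (a k / b) ≤ N,
-- i.e. ∏ k ^ (a k) ≤ N ^ b.
SqrtExpProdLE : ℕ → (ℕ → ℕ) → (ℕ → ℕ) → ℕ → Set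
SqrtExpProdLE n d m N =
  ∀ (b : ℕ) → 1 ≤ b → ∀ (a : ℕ → ℕ) →
  (∀ k → 1 ≤ k → k ≤ n → (d k * a k) ^ 2 ≤ b ^ 2 * m k) →
  prod n (λ k → k ^ a k) ≤ N ^ b

{-# OPTIONS --safe #-}
-- Every inequality reduces, factor by factor, to two elementary bounds on k!:
-- k^k ≤ (k!)², since k! · k! = ∏ᵢ i (k + 1 − i) and each such factor is at
-- least k; and k! · 2^k ≤ (k + 1)^k, by induction on k using Bernoulli's
-- inequality (1 + 1/k)^k ≥ 2.
module Submission where

open import Data.Nat using (ℕ; zero; suc; _+_; _*_; _∸_; _^_; _≤_; _!; NonZero; >-nonZero; z≤n; s≤s)
open import Data.Nat.Properties
open import Data.Nat.Tactic.RingSolver using (solve; solve-∀)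
open import Data.List using ([]; _∷_)
open import Data.Product using (_×_; _,_)
open import Relation.Binary.PropositionalEquality using (_≡_; refl; sym; cong; subst)
open import Relation.Nullary using (yes; no; contradiction)
open import Defs

open ≤-Reasoning

prod-mono-≤ : ∀ n {f g : ℕ → ℕ} → (∀ k → 1 ≤ k → k ≤ n → f k ≤ g k) → prod n f ≤ prod n g
prod-mono-≤ zero    f≤g = ≤-refl
prod-mono-≤ (suc n) f≤g =
  *-mono-≤ (prod-mono-≤ n λ k 1≤k k≤n → f≤g k 1≤k (m≤n⇒m≤1+n k≤n)) (f≤g (suc n) (s≤s z≤n) ≤-refl)

^-distrib-* : ∀ m n o → (m * n) ^ o ≡ m ^ o * n ^ o
^-distrib-* m n zero    = refl
^-distrib-* m n (suc o) = begin-equality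
  m * n * (m * n) ^ o      ≡⟨ cong (m * n *_) (^-distrib-* m n o) ⟩
  m * n * (m ^ o * n ^ o)  ≡⟨ [m*n]*[o*p]≡[m*o]*[n*p] m n (m ^ o) (n ^ o) ⟩
  m ^ suc o * n ^ suc o    ∎

prod-distrib-^ : ∀ n f e → prod n (λ k → f k ^ e) ≡ prod n f ^ e
prod-distrib-^ zero    f e = sym (^-zeroˡ e)
prod-distrib-^ (suc n) f e = begin-equality
  prod n (λ k → f k ^ e) * f (suc n) ^ e  ≡⟨ cong (_* f (suc n) ^ e) (prod-distrib-^ n f e) ⟩
  prod n f ^ e * f (suc n) ^ e            ≡⟨ sym (^-distrib-* (prod n f) (f (suc n)) e) ⟩
  (prod n f * f (suc n)) ^ e              ∎

prod-distrib-* : ∀ n f g → prod n (λ k → f k * g k) ≡ prod n f * prod n g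
prod-distrib-* zero    f g = refl
prod-distrib-* (suc n) f g = begin-equality
  prod n (λ k → f k * g k) * (f (suc n) * g (suc n))
    ≡⟨ cong (_* (f (suc n) * g (suc n))) (prod-distrib-* n f g) ⟩
  prod n f * prod n g * (f (suc n) * g (suc n))
    ≡⟨ [m*n]*[o*p]≡[m*o]*[n*p] (prod n f) (prod n g) (f (suc n)) (g (suc n)) ⟩
  prod n f * f (suc n) * (prod n g * g (suc n))
    ∎

n^2≡n*n : ∀ n → n ^ 2 ≡ n * n
n^2≡n*n n = cong (n *_) (*-identityʳ n)

^-cancelʳ-≤ : ∀ e .{{_ : NonZero e}} {m n} → m ^ e ≤ n ^ e → m ≤ n
^-cancelʳ-≤ e {m} {n} mᵉ≤nᵉ with m ≤? n
... | yes m≤n = m≤n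
... | no  m≰n = contradiction mᵉ≤nᵉ (<⇒≱ (^-monoˡ-< e (≰⇒> m≰n)))

y^2≤b^2*m∧m≤c^2⇒y≤c*b : ∀ {y b m} c → y ^ 2 ≤ b ^ 2 * m → m ≤ c ^ 2 → y ≤ c * b
y^2≤b^2*m∧m≤c^2⇒y≤c*b {y} {b} {m} c y²≤b²m m≤c² = ^-cancelʳ-≤ 2 (begin
  y ^ 2          ≤⟨ y²≤b²m ⟩
  b ^ 2 * m      ≤⟨ *-monoʳ-≤ (b ^ 2) m≤c² ⟩
  b ^ 2 * c ^ 2  ≡⟨ *-comm (b ^ 2) (c ^ 2) ⟩
  c ^ 2 * b ^ 2  ≡⟨ sym (^-distrib-* c b 2) ⟩
  (c * b) ^ 2    ∎)

-- Generalises k^k ≤ k! · k! (the case r = 0) so that induction on j goes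
-- through; the step is r + j + 1 ≤ (j + 1)(r + 1).
[r+j]^j*r!≤j!*[r+j]! : ∀ r j → (r + j) ^ j * r ! ≤ j ! * (r + j) !
[r+j]^j*r!≤j!*[r+j]! r zero rewrite +-identityʳ r = ≤-refl
[r+j]^j*r!≤j!*[r+j]! r (suc j) rewrite +-suc r j = begin
  N * N ^ j * r !                  ≤⟨ *-monoˡ-≤ (r !) (*-monoˡ-≤ (N ^ j) N≤[1+j]*[1+r]) ⟩
  suc j * suc r * N ^ j * r !      ≡⟨ regroup (suc j) (suc r) (N ^ j) (r !) ⟩
  suc j * (N ^ j * (suc r * r !))  ≤⟨ *-monoʳ-≤ (suc j) ([r+j]^j*r!≤j!*[r+j]! (suc r) j) ⟩
  suc j * (j ! * N !)              ≡⟨ sym (*-assoc (suc j) (j !) (N !)) ⟩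
  suc j * j ! * N !                ∎
  where
  N : ℕ
  N = suc (r + j)
  N≤[1+j]*[1+r] : suc (r + j) ≤ suc j * suc r
  N≤[1+j]*[1+r] = ≤-trans (m≤m+n (suc (r + j)) (j * r)) (≤-reflexive (solve (r ∷ j ∷ [])))
  regroup : ∀ a b c d → a * b * c * d ≡ a * (c * (b * d))
  regroup = solve-∀

n^n≤[n!]^2 : ∀ n → n ^ n ≤ (n !) ^ 2
n^n≤[n!]^2 n = begin
  n ^ n          ≡⟨ sym (*-identityʳ (n ^ n)) ⟩
  n ^ n * 0 !    ≤⟨ [r+j]^j*r!≤j!*[r+j]! 0 n ⟩
  n ! * n !      ≡⟨ sym (n^2≡n*n (n !)) ⟩
  (n !) ^ 2      ∎

n^[n*e]≤[n!^e]^2 : ∀ n e → n ^ (n * e) ≤ ((n !) ^ e) ^ 2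
n^[n*e]≤[n!^e]^2 n e = begin
  n ^ (n * e)        ≡⟨ sym (^-*-assoc n n e) ⟩
  (n ^ n) ^ e        ≤⟨ ^-monoˡ-≤ e (n^n≤[n!]^2 n) ⟩
  ((n !) ^ 2) ^ e    ≡⟨ ^-*-assoc (n !) 2 e ⟩
  (n !) ^ (2 * e)    ≡⟨ cong ((n !) ^_) (*-comm 2 e) ⟩
  (n !) ^ (e * 2)    ≡⟨ sym (^-*-assoc (n !) e 2) ⟩
  ((n !) ^ e) ^ 2    ∎

n^[n+2]≤[n*n!]^2 : ∀ n → n ^ (n + 2) ≤ (n * n !) ^ 2
n^[n+2]≤[n*n!]^2 n = begin
  n ^ (n + 2)          ≡⟨ ^-distribˡ-+-* n n 2 ⟩
  n ^ n * n ^ 2        ≤⟨ *-monoˡ-≤ (n ^ 2) (n^n≤[n!]^2 n) ⟩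
  (n !) ^ 2 * n ^ 2    ≡⟨ *-comm ((n !) ^ 2) (n ^ 2) ⟩
  n ^ 2 * (n !) ^ 2    ≡⟨ sym (^-distrib-* n (n !) 2) ⟩
  (n * n !) ^ 2        ∎

m^j*[m+j]≤[m+1]^j*m : ∀ m j → m ^ j * (m + j) ≤ (m + 1) ^ j * m
m^j*[m+j]≤[m+1]^j*m m zero    = ≤-reflexive (cong (1 *_) (+-identityʳ m))
m^j*[m+j]≤[m+1]^j*m m (suc j) = begin
  m * m ^ j * (m + suc j)          ≡⟨ regroupˡ m (m ^ j) (m + suc j) ⟩
  m ^ j * (m * (m + suc j))        ≤⟨ *-monoʳ-≤ (m ^ j) (m≤m+n _ j) ⟩
  m ^ j * (m * (m + suc j) + j)    ≡⟨ cong (m ^ j *_) (solve (m ∷ j ∷ [])) ⟩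
  m ^ j * ((m + j) * (m + 1))      ≡⟨ sym (*-assoc (m ^ j) (m + j) (m + 1)) ⟩
  m ^ j * (m + j) * (m + 1)        ≤⟨ *-monoˡ-≤ (m + 1) (m^j*[m+j]≤[m+1]^j*m m j) ⟩
  (m + 1) ^ j * m * (m + 1)        ≡⟨ regroupʳ ((m + 1) ^ j) m (m + 1) ⟩
  (m + 1) * (m + 1) ^ j * m        ∎
  where
  regroupˡ : ∀ a b c → a * b * c ≡ b * (a * c)
  regroupˡ = solve-∀
  regroupʳ : ∀ a b c → a * b * c ≡ c * a * b
  regroupʳ = solve-∀

2*n^n≤[n+1]^n : ∀ n .{{_ : NonZero n}} → 2 * n ^ n ≤ (n + 1) ^ n
2*n^n≤[n+1]^n n = *-cancelʳ-≤ (2 * n ^ n) ((n + 1) ^ n) n (begin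
  2 * n ^ n * n      ≡⟨ regroup (n ^ n) n ⟩
  n ^ n * (n + n)    ≤⟨ m^j*[m+j]≤[m+1]^j*m n n ⟩
  (n + 1) ^ n * n    ∎)
  where
  regroup : ∀ a b → 2 * a * b ≡ a * (b + b)
  regroup = solve-∀

n!*2^n≤[n+1]^n : ∀ n → n ! * 2 ^ n ≤ (n + 1) ^ n
n!*2^n≤[n+1]^n zero    = ≤-refl
n!*2^n≤[n+1]^n (suc n) = begin
  suc n * n ! * (2 * 2 ^ n)  ≡⟨ [m*n]*[o*p]≡[m*o]*[n*p] (suc n) (n !) 2 (2 ^ n) ⟩
  suc n * 2 * (n ! * 2 ^ n)  ≤⟨ *-monoʳ-≤ (suc n * 2) (n!*2^n≤[n+1]^n n) ⟩
  suc n * 2 * (n + 1) ^ n    ≡⟨ cong (λ m → suc n * 2 * m ^ n) (+-comm n 1) ⟩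
  suc n * 2 * suc n ^ n      ≡⟨ cong (_* suc n ^ n) (*-comm (suc n) 2) ⟩
  2 * suc n * suc n ^ n      ≡⟨ *-assoc 2 (suc n) (suc n ^ n) ⟩
  2 * suc n ^ suc n          ≤⟨ 2*n^n≤[n+1]^n (suc n) ⟩
  (suc n + 1) ^ suc n        ∎

n!^e*2^[n*e]≤[n+1]^[n*e] : ∀ n e → (n !) ^ e * 2 ^ (n * e) ≤ (n + 1) ^ (n * e)
n!^e*2^[n*e]≤[n+1]^[n*e] n e = begin
  (n !) ^ e * 2 ^ (n * e)    ≡⟨ cong ((n !) ^ e *_) (sym (^-*-assoc 2 n e)) ⟩
  (n !) ^ e * (2 ^ n) ^ e    ≡⟨ sym (^-distrib-* (n !) (2 ^ n) e) ⟩
  (n ! * 2 ^ n) ^ e          ≤⟨ ^-monoˡ-≤ e (n!*2^n≤[n+1]^n n) ⟩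
  ((n + 1) ^ n) ^ e          ≡⟨ ^-*-assoc (n + 1) n e ⟩
  (n + 1) ^ (n * e)          ∎

m!*2^n≤[m+1]^m*2^[n∸m] : ∀ {m n} → m ≤ n → m ! * 2 ^ n ≤ (m + 1) ^ m * 2 ^ (n ∸ m)
m!*2^n≤[m+1]^m*2^[n∸m] {m} {n} m≤n = begin
  m ! * 2 ^ n                  ≡⟨ cong (λ e → m ! * 2 ^ e) (sym (m+[n∸m]≡n m≤n)) ⟩
  m ! * 2 ^ (m + (n ∸ m))      ≡⟨ cong (m ! *_) (^-distribˡ-+-* 2 m (n ∸ m)) ⟩
  m ! * (2 ^ m * 2 ^ (n ∸ m))  ≡⟨ sym (*-assoc (m !) (2 ^ m) (2 ^ (n ∸ m))) ⟩
  m ! * 2 ^ m * 2 ^ (n ∸ m)    ≤⟨ *-monoˡ-≤ (2 ^ (n ∸ m)) (n!*2^n≤[n+1]^n m) ⟩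
  (m + 1) ^ m * 2 ^ (n ∸ m)    ∎

SqrtExpProdLE-termwise : ∀ n d m f →
  (∀ b x {k} → 1 ≤ k → (d k * x) ^ 2 ≤ b ^ 2 * m k → k ^ x ≤ f k ^ b) →
  SqrtExpProdLE n d m (prod n f)
SqrtExpProdLE-termwise n d m f bound b _ a a-ok = begin
  prod n (λ k → k ^ a k)  ≤⟨ prod-mono-≤ n (λ k 1≤k k≤n → bound b (a k) 1≤k (a-ok k 1≤k k≤n)) ⟩
  prod n (λ k → f k ^ b)  ≡⟨ prod-distrib-^ n f b ⟩
  prod n f ^ b            ∎

F₁-lower : ∀ n → SqrtExpProdLE n (λ k → 1) (λ k → k ^ k) (F₁ n)
F₁-lower n = SqrtExpProdLE-termwise n (λ k → 1) (λ k → k ^ k) (λ k → k ^ (k !)) bound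
  where
  bound : ∀ b x {k} → 1 ≤ k → (1 * x) ^ 2 ≤ b ^ 2 * k ^ k → k ^ x ≤ (k ^ (k !)) ^ b
  bound b x {k} 1≤k x²≤b²kᵏ = begin
    k ^ x            ≤⟨ ^-monoʳ-≤ k {{>-nonZero 1≤k}} x≤k!*b ⟩
    k ^ (k ! * b)    ≡⟨ sym (^-*-assoc k (k !) b) ⟩
    (k ^ (k !)) ^ b  ∎
    where
    x≤k!*b : x ≤ k ! * b
    x≤k!*b = subst (_≤ k ! * b) (*-identityˡ x)
               (y^2≤b^2*m∧m≤c^2⇒y≤c*b (k !) x²≤b²kᵏ (n^n≤[n!]^2 k))

F₁-upper : ∀ n → F₁ n ^ (2 ^ n) ≤ prod n (λ k → k ^ ((k + 1) ^ k * 2 ^ (n ∸ k)))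
F₁-upper n = begin
  F₁ n ^ (2 ^ n)                                  ≡⟨ sym (prod-distrib-^ n (λ k → k ^ (k !)) (2 ^ n)) ⟩
  prod n (λ k → (k ^ (k !)) ^ (2 ^ n))            ≤⟨ prod-mono-≤ n bound ⟩
  prod n (λ k → k ^ ((k + 1) ^ k * 2 ^ (n ∸ k)))  ∎
  where
  bound : ∀ k → 1 ≤ k → k ≤ n → (k ^ (k !)) ^ (2 ^ n) ≤ k ^ ((k + 1) ^ k * 2 ^ (n ∸ k))
  bound k 1≤k k≤n = begin
    (k ^ (k !)) ^ (2 ^ n)             ≡⟨ ^-*-assoc k (k !) (2 ^ n) ⟩
    k ^ (k ! * 2 ^ n)                 ≤⟨ ^-monoʳ-≤ k {{>-nonZero 1≤k}} (m!*2^n≤[m+1]^m*2^[n∸m] k≤n) ⟩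
    k ^ ((k + 1) ^ k * 2 ^ (n ∸ k))   ∎

F₂-lower : ∀ n → prod n (λ k → k ^ (k ^ 2)) ≤ F₂ n ^ 2
F₂-lower n = begin
  prod n (λ k → k ^ (k ^ 2))         ≤⟨ prod-mono-≤ n bound ⟩
  prod n (λ k → ((k !) ^ k) ^ 2)     ≡⟨ prod-distrib-^ n (λ k → (k !) ^ k) 2 ⟩
  F₂ n ^ 2                           ∎
  where
  bound : ∀ k → 1 ≤ k → k ≤ n → k ^ (k ^ 2) ≤ ((k !) ^ k) ^ 2
  bound k _ _ rewrite n^2≡n*n k = n^[n*e]≤[n!^e]^2 k k

F₂-upper : ∀ n → F₂ n * prod n (λ k → 2 ^ (k ^ 2)) ≤ prod n (λ k → (k + 1) ^ (k ^ 2))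
F₂-upper n = begin
  F₂ n * prod n (λ k → 2 ^ (k ^ 2))      ≡⟨ sym (prod-distrib-* n (λ k → (k !) ^ k) (λ k → 2 ^ (k ^ 2))) ⟩
  prod n (λ k → (k !) ^ k * 2 ^ (k ^ 2))  ≤⟨ prod-mono-≤ n bound ⟩
  prod n (λ k → (k + 1) ^ (k ^ 2))        ∎
  where
  bound : ∀ k → 1 ≤ k → k ≤ n → (k !) ^ k * 2 ^ (k ^ 2) ≤ (k + 1) ^ (k ^ 2)
  bound k _ _ rewrite n^2≡n*n k = n!^e*2^[n*e]≤[n+1]^[n*e] k k

F₃-lower : ∀ n → SqrtExpProdLE n (λ k → 2) (λ k → k ^ (k + 2)) (F₃ n)
F₃-lower n = SqrtExpProdLE-termwise n (λ k → 2) (λ k → k ^ (k + 2)) (λ k → (k !) ^ (k !)) bound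
  where
  bound : ∀ b x {k} → 1 ≤ k → (2 * x) ^ 2 ≤ b ^ 2 * k ^ (k + 2) → k ^ x ≤ ((k !) ^ (k !)) ^ b
  bound b x {k} 1≤k [2x]²≤b²kᵏ⁺² = ^-cancelʳ-≤ 2 (begin
    (k ^ x) ^ 2                ≡⟨ ^-*-assoc k x 2 ⟩
    k ^ (x * 2)                ≡⟨ cong (k ^_) (*-comm x 2) ⟩
    k ^ (2 * x)                ≤⟨ ^-monoʳ-≤ k {{>-nonZero 1≤k}} 2x≤k*k!*b ⟩
    k ^ (k * k ! * b)          ≡⟨ cong (k ^_) (*-assoc k (k !) b) ⟩
    k ^ (k * (k ! * b))        ≤⟨ n^[n*e]≤[n!^e]^2 k (k ! * b) ⟩
    ((k !) ^ (k ! * b)) ^ 2    ≡⟨ cong (_^ 2) (sym (^-*-assoc (k !) (k !) b)) ⟩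
    (((k !) ^ (k !)) ^ b) ^ 2  ∎)
    where
    2x≤k*k!*b : 2 * x ≤ k * k ! * b
    2x≤k*k!*b = y^2≤b^2*m∧m≤c^2⇒y≤c*b (k * k !) [2x]²≤b²kᵏ⁺² (n^[n+2]≤[n*n!]^2 k)

F₃-upper : ∀ n →
  F₃ n ^ (2 ^ n) * prod n (λ k → 2 ^ (k * (k + 1) ^ k * 2 ^ (n ∸ k)))
    ≤ prod n (λ k → (k + 1) ^ (k * (k + 1) ^ k * 2 ^ (n ∸ k)))
F₃-upper n = begin
  F₃ n ^ (2 ^ n) * prod n (λ k → 2 ^ E k)
    ≡⟨ cong (_* prod n (λ k → 2 ^ E k)) (sym (prod-distrib-^ n (λ k → (k !) ^ (k !)) (2 ^ n))) ⟩
  prod n (λ k → ((k !) ^ (k !)) ^ (2 ^ n)) * prod n (λ k → 2 ^ E k)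
    ≡⟨ sym (prod-distrib-* n (λ k → ((k !) ^ (k !)) ^ (2 ^ n)) (λ k → 2 ^ E k)) ⟩
  prod n (λ k → ((k !) ^ (k !)) ^ (2 ^ n) * 2 ^ E k)
    ≤⟨ prod-mono-≤ n bound ⟩
  prod n (λ k → (k + 1) ^ E k)
    ∎
  where
  E : ℕ → ℕ
  E k = k * (k + 1) ^ k * 2 ^ (n ∸ k)
  bound : ∀ k → 1 ≤ k → k ≤ n → ((k !) ^ (k !)) ^ (2 ^ n) * 2 ^ E k ≤ (k + 1) ^ E k
  bound k _ k≤n rewrite *-assoc k ((k + 1) ^ k) (2 ^ (n ∸ k)) = begin
    ((k !) ^ (k !)) ^ (2 ^ n) * 2 ^ (k * e)
      ≡⟨ cong (_* 2 ^ (k * e)) (^-*-assoc (k !) (k !) (2 ^ n)) ⟩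
    (k !) ^ (k ! * 2 ^ n) * 2 ^ (k * e)
      ≤⟨ *-monoˡ-≤ (2 ^ (k * e)) (^-monoʳ-≤ (k !) {{k !≢0}} (m!*2^n≤[m+1]^m*2^[n∸m] k≤n)) ⟩
    (k !) ^ e * 2 ^ (k * e)
      ≤⟨ n!^e*2^[n*e]≤[n+1]^[n*e] k e ⟩
    (k + 1) ^ (k * e)
      ∎
    where
    e : ℕ
    e = (k + 1) ^ k * 2 ^ (n ∸ k)

mainTheorem3 : (n : ℕ) → 1 ≤ n →
    SqrtExpProdLE n (λ k → 1) (λ k → k ^ k) (F₁ n)
    × (F₁ n ^ (2 ^ n) ≤ prod n (λ k → k ^ ((k + 1) ^ k * 2 ^ (n ∸ k))))
    × (prod n (λ k → k ^ (k ^ 2)) ≤ F₂ n ^ 2)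
    × (F₂ n * prod n (λ k → 2 ^ (k ^ 2)) ≤ prod n (λ k → (k + 1) ^ (k ^ 2)))
    × SqrtExpProdLE n (λ k → 2) (λ k → k ^ (k + 2)) (F₃ n)
    × (F₃ n ^ (2 ^ n) * prod n (λ k → 2 ^ (k * (k + 1) ^ k * 2 ^ (n ∸ k)))
        ≤ prod n (λ k → (k + 1) ^ (k * (k + 1) ^ k * 2 ^ (n ∸ k))))
mainTheorem3 n _ = F₁-lower n , F₁-upper n , F₂-lower n , F₂-upper n , F₃-lower n , F₃-upper n
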